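{- Given an $n$-vertex undirected simple graph $G$ (as an edge stream) and an integer $k$, there exists a deterministic streaming algorithm using $O(k\log n)$ passes and $\tilde O(kn)$ space that either outputs the partition of $V(G)$ into the vertex sets of the connected components of the complement graph $\overline{G}$, or finds an induced copy of $\text{co- }P_{k+2}$ in $G$.
   Context: $\overline{G}$ is the complement of $G$; $P_\ell$ is the path on $\ell$ vertices and $\text{co- }P_\ell$ its complement. Insertion-only graph streaming model: the edges of $G$ arrive as a stream in arbitrary order; the algorithm knows $n$, may scan the stream from beginning to end a number of times (passes), and has bounded memory measured in bits. $\tilde O$ hides polylogarithmic factors in $n$. -}

module Defs where

open import Data.Nat using (ℕ; zero; suc; _+_; _*_; _^_; _≤_; _∸_)
open import Data.Nat.Logarithm using (⌈log₂_⌉)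
open import Data.Fin using (Fin; toℕ)
open import Data.Fin.Properties using () renaming (_≟_ to _≟F_)
open import Data.Bool using (Bool; true; false)
open import Data.Vec using (Vec)
open import Data.List using (List; []; _∷_; foldl)
open import Data.List.Membership.Propositional using (_∈_)
open import Data.Product using (Σ; _×_; _,_; proj₁; proj₂; ∃)
open import Data.Sum using (_⊎_; inj₁; inj₂)
open import Data.Maybe using (Maybe; just; nothing)
open import Relation.Nullary using (¬_; yes; no)
open import Relation.Binary.PropositionalEquality using (_≡_; _≢_)
open import Relation.Binary.Construct.Closure.ReflexiveTransitive using (Star)
open import Function.Bundles using (_⇔_)
open import Function.Definitions using (Injective)

record Graph (n : ℕ) : Set where
  field
    adj     : Fin n → Fin n → Bool
    sym     : ∀ u v → adj u v ≡ adj v u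
    irrefl  : ∀ u → adj u u ≡ false
open Graph public

Adj : ∀ {n} → Graph n → Fin n → Fin n → Set
Adj G u v = adj G u v ≡ true

CoAdj : ∀ {n} → Graph n → Fin n → Fin n → Set
CoAdj G u v = (u ≢ v) × (adj G u v ≡ false)

CoConnected : ∀ {n} → Graph n → Fin n → Fin n → Set
CoConnected G = Star (CoAdj G)

-- Edge streams: a stream item is an (arbitrarily oriented) pair of endpoints.
Edge : ℕ → Set
Edge n = Fin n × Fin n

countPair : ∀ {n} → Fin n → Fin n → List (Edge n) → ℕ
countPair u v [] = 0
countPair u v ((a , b) ∷ l) with a ≟F u | b ≟F v | a ≟F v | b ≟F u
... | yes _ | yes _ | _     | _     = suc (countPair u v l)
... | _     | _     | yes _ | yes _ = suc (countPair u v l)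
... | _     | _     | _     | _     = countPair u v l

IsStreamOf : ∀ {n} → Graph n → List (Edge n) → Set
IsStreamOf G L =
  (∀ e → e ∈ L → Adj G (proj₁ e) (proj₂ e)) ×
  (∀ u v → Adj G u v → countPair u v L ≡ 1)

Mem : ℕ → Set
Mem s = Vec Bool s

record StreamAlg (n s : ℕ) (Out : Set) : Set where
  field
    init    : Mem s
    step    : Mem s → Edge n → Mem s
    endPass : Mem s → Mem s ⊎ Out
open StreamAlg public

runPass : ∀ {n s Out} → StreamAlg n s Out → Mem s → List (Edge n) → Mem s
runPass A m L = foldl (step A) m L

runFrom : ∀ {n s Out} → StreamAlg n s Out → ℕ → Mem s → List (Edge n) → Maybe Out
runFrom A zero    m L = nothing
runFrom A (suc p) m L with endPass A (runPass A m L)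
... | inj₁ m' = runFrom A p m' L
... | inj₂ o  = just o

run : ∀ {n s Out} → StreamAlg n s Out → ℕ → List (Edge n) → Maybe Out
run A p L = runFrom A p (init A) L

PathAdj : ∀ {ℓ} → Fin ℓ → Fin ℓ → Set
PathAdj i j = (toℕ i ≡ suc (toℕ j)) ⊎ (toℕ j ≡ suc (toℕ i))

CoPathAdj : ∀ {ℓ} → Fin ℓ → Fin ℓ → Set
CoPathAdj i j = (i ≢ j) × ¬ PathAdj i j

InducedCoPath : ∀ {n} (ℓ : ℕ) → Graph n → (Fin ℓ → Fin n) → Set
InducedCoPath ℓ G φ = Injective _≡_ _≡_ φ × (∀ i j → Adj G (φ i) (φ j) ⇔ CoPathAdj i j)

-- Possible outputs: a labelling of vertices whose classes are the parts of
-- the partition, or an embedding of co-P_{k+2}.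
Output : ℕ → ℕ → Set
Output n k = (Fin n → Fin n) ⊎ (Fin (k + 2) → Fin n)

Correct : ∀ {n} (k : ℕ) → Graph n → Output n k → Set
Correct k G (inj₁ f) = ∀ u v → (f u ≡ f v) ⇔ CoConnected G u v
Correct k G (inj₂ φ) = InducedCoPath (k + 2) G φ

Solves : ∀ {n s} (k : ℕ) → StreamAlg n s (Output n k) → ℕ → Set
Solves {n} k A p = ∀ (G : Graph n) (L : List (Edge n)) → IsStreamOf G L →
  Σ (Output n k) λ o → (run A p L ≡ just o) × Correct k G o

{-# OPTIONS --safe #-}
-- One pass over the edge stream answers, for every vertex v at once, whether a set
-- Q(v) of vertices contains a non-neighbour of v: count the stream edges from v into Q(v) and
-- compare with |Q(v)|. This needs n counters of O(log n) bits, and W = ⌈log₂ n⌉ + 1 such passes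
-- find by binary search, for every v, the least key over the closed co-neighbourhood of v.
-- Propagating least vertex indices for k + 1 rounds gives, for every v, the least index within
-- co-distance k and within co-distance k + 1. If the two agree everywhere, the labels are
-- constant exactly on the components of the complement. Otherwise some y has a vertex a at
-- co-distance exactly k + 1; k + 1 BFS passes in the complement give the co-distances from a,
-- and one more binary search gives every vertex a co-neighbour one step closer to a. Walking
-- back from y yields a shortest path of k + 2 vertices in the complement; being shortest, it is
-- induced, so it is an induced co-P_{k+2} in G.
module Submission where

open import Defs hiding (sym)
open import Data.Bool using (Bool; true; false; _∧_; not; T; if_then_else_)
open import Data.Bool.Properties using (T?) renaming (_≟_ to _≟B_)
open import Data.Empty using (⊥-elim)
open import Data.Fin using (Fin; zero; suc; toℕ)
open import Data.Fin.Properties using (any?; toℕ-fromℕ<; toℕ<n; toℕ-injective) renaming (_≟_ to _≟F_)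
open import Data.List using (List; []; _∷_)
open import Data.List.Membership.Propositional using (_∈_)
open import Data.List.Relation.Unary.Any using (here; there)
open import Data.Maybe using (Maybe; just; nothing)
open import Data.Nat using (ℕ; zero; suc; _+_; _*_; _∸_; _^_; _<_; _≤_; _<?_; _≤?_; s≤s; z≤n; ⌊_/2⌋; ⌈_/2⌉; NonZero)
open import Data.Nat.DivMod using (_mod_; m%n<n; m<n⇒m%n≡m)
open import Data.Nat.GeneralisedArithmetic using (fold)
open import Data.Nat.Induction using (<-wellFounded)
open import Data.Nat.Logarithm using (⌈log₂_⌉)
open import Data.Nat.Logarithm.Core using (⌈log2⌉)
open import Data.Nat.Properties
open import Data.Nat.Tactic.RingSolver using (solve-∀)
open import Algebra.Properties.CommutativeMonoid.Sum +-0-commutativeMonoid using (sum; ∑-distrib-+; sum-cong-≗; sum-replicate-zero)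
open import Data.Product using (Σ; _×_; _,_; proj₁; proj₂; ∃)
open import Data.Sum using (_⊎_; inj₁; inj₂; [_,_]′; map₁; swap)
open import Data.Vec using (Vec; []; _∷_; _++_; take; drop; map; concat; lookup; tabulate; replicate)
open import Data.Vec.Properties using (take++drop≡id; ++-injective; lookup∘tabulate; tabulate-cong; lookup-replicate)
open import Data.Vec.Relation.Unary.All using (All; []; _∷_)
open import Data.Vec.Relation.Unary.All.Properties using (++⁺; lookup⁻; tabulate⁺)
open import Function.Bundles using (_⇔_; mk⇔; Equivalence)
open import Induction.WellFounded using (Acc; acc)
open import Relation.Binary.Construct.Closure.ReflexiveTransitive using (ε; _◅_; _◅◅_; reverse)
open import Relation.Binary.Definitions using (tri<; tri≈; tri>)
open import Relation.Binary.PropositionalEquality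
open import Relation.Nullary using (¬_; Dec; yes; no; ¬?; does; proof)
open import Relation.Nullary.Decidable using (⌊_⌋; toWitness; fromWitness; decidable-stable; _×-dec_; does-⇔)
open import Relation.Nullary.Reflects using (Reflects; ofʸ; ofⁿ)

fromBool : Bool → ℕ
fromBool false = 0
fromBool true  = 1

fromBool≤1 : ∀ b → fromBool b ≤ 1
fromBool≤1 false = z≤n
fromBool≤1 true  = s≤s z≤n

odd : ℕ → Bool
odd zero          = false
odd (suc zero)    = true
odd (suc (suc x)) = odd x

odd+2*⌊n/2⌋≡n : ∀ x → fromBool (odd x) + 2 * ⌊ x /2⌋ ≡ x
odd+2*⌊n/2⌋≡n zero          = refl
odd+2*⌊n/2⌋≡n (suc zero)    = refl
odd+2*⌊n/2⌋≡n (suc (suc x)) = begin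
  fromBool (odd x) + 2 * suc ⌊ x /2⌋    ≡⟨ cong (fromBool (odd x) +_) (*-suc 2 ⌊ x /2⌋) ⟩
  fromBool (odd x) + (2 + 2 * ⌊ x /2⌋)  ≡⟨ +-suc (fromBool (odd x)) _ ⟩
  suc (fromBool (odd x) + suc (2 * ⌊ x /2⌋)) ≡⟨ cong suc (+-suc (fromBool (odd x)) _) ⟩
  suc (suc (fromBool (odd x) + 2 * ⌊ x /2⌋)) ≡⟨ cong (λ y → suc (suc y)) (odd+2*⌊n/2⌋≡n x) ⟩
  suc (suc x)                           ∎
  where open ≡-Reasoning

-- Little-endian, truncated to the lowest z bits.
toBits : ∀ z → ℕ → Vec Bool z
toBits zero    x = []
toBits (suc z) x = odd x ∷ toBits z ⌊ x /2⌋

fromBits : ∀ {z} → Vec Bool z → ℕ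
fromBits []       = 0
fromBits (b ∷ bs) = fromBool b + 2 * fromBits bs

fromBits<2^ : ∀ {z} (bs : Vec Bool z) → fromBits bs < 2 ^ z
fromBits<2^ []       = s≤s z≤n
fromBits<2^ {suc z} (b ∷ bs) = begin-strict
  fromBool b + 2 * fromBits bs  ≤⟨ +-monoˡ-≤ _ (fromBool≤1 b) ⟩
  1 + 2 * fromBits bs           <⟨ n<1+n _ ⟩
  2 + 2 * fromBits bs           ≡⟨ *-suc 2 (fromBits bs) ⟨
  2 * suc (fromBits bs)         ≤⟨ *-monoʳ-≤ 2 (fromBits<2^ bs) ⟩
  2 * 2 ^ z                     ∎
  where open ≤-Reasoning

fromBits-toBits : ∀ z {x} → x < 2 ^ z → fromBits (toBits z x) ≡ x
fromBits-toBits zero    {zero}  _ = refl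
fromBits-toBits zero    {suc x} (s≤s ())
fromBits-toBits (suc z) {x} x<2^1+z = begin
  fromBool (odd x) + 2 * fromBits (toBits z ⌊ x /2⌋)
    ≡⟨ cong (λ h → fromBool (odd x) + 2 * h) (fromBits-toBits z ⌊x/2⌋<2^z) ⟩
  fromBool (odd x) + 2 * ⌊ x /2⌋
    ≡⟨ odd+2*⌊n/2⌋≡n x ⟩
  x ∎
  where
  open ≡-Reasoning
  ⌊x/2⌋<2^z : ⌊ x /2⌋ < 2 ^ z
  ⌊x/2⌋<2^z = *-cancelˡ-< 2 _ _ (≤-<-trans (m≤n+m _ (fromBool (odd x)))
                (subst (_< 2 ^ suc z) (sym (odd+2*⌊n/2⌋≡n x)) x<2^1+z))

wrap : ℕ → ℕ → ℕ
wrap z x = fromBits (toBits z x)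

map-wrap-bounded : ∀ z {r} {xs : Vec ℕ r} → All (_< 2 ^ z) xs → map (wrap z) xs ≡ xs
map-wrap-bounded z []         = refl
map-wrap-bounded z (x< ∷ xs<) = cong₂ _∷_ (fromBits-toBits z x<) (map-wrap-bounded z xs<)

take-++ : ∀ {A : Set} m {l} (xs : Vec A m) (ys : Vec A l) → take m (xs ++ ys) ≡ xs
take-++ m xs ys = proj₁ (++-injective _ _ (take++drop≡id m (xs ++ ys)))

drop-++ : ∀ {A : Set} m {l} (xs : Vec A m) (ys : Vec A l) → drop m (xs ++ ys) ≡ ys
drop-++ m xs ys = proj₂ (++-injective _ _ (take++drop≡id m (xs ++ ys)))

encodeRegs : ∀ z {r} → Vec ℕ r → Vec Bool (r * z)
encodeRegs z xs = concat (map (toBits z) xs)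

decodeRegs : ∀ z r → Vec Bool (r * z) → Vec ℕ r
decodeRegs z zero    bs = []
decodeRegs z (suc r) bs = fromBits (take z bs) ∷ decodeRegs z r (drop z bs)

decodeRegs-encodeRegs : ∀ z {r} (xs : Vec ℕ r) → decodeRegs z r (encodeRegs z xs) ≡ map (wrap z) xs
decodeRegs-encodeRegs z []       = refl
decodeRegs-encodeRegs z (x ∷ xs) = cong₂ _∷_
  (cong fromBits (take-++ z (toBits z x) (encodeRegs z xs)))
  (trans (cong (decodeRegs z _) (drop-++ z (toBits z x) (encodeRegs z xs))) (decodeRegs-encodeRegs z xs))

≤-sum : ∀ {n} (f : Fin n → ℕ) u → f u ≤ sum f
≤-sum f zero    = m≤m+n _ _
≤-sum f (suc u) = ≤-trans (≤-sum (λ v → f (suc v)) u) (m≤n+m _ _)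

sum-positive : ∀ {n} (f : Fin n → ℕ) → 0 < sum f → ∃ λ u → 0 < f u
sum-positive {suc n} f 0<∑f with f zero in f0≡
... | suc _ = zero , subst (0 <_) (sym f0≡) (s≤s z≤n)
... | zero  with sum-positive (λ u → f (suc u)) 0<∑f
...   | u , 0<fu = suc u , 0<fu

count : ∀ {n} → (Fin n → Bool) → ℕ
count q = sum (λ u → fromBool (q u))

count≤n : ∀ {n} (q : Fin n → Bool) → count q ≤ n
count≤n {zero}  q = z≤n
count≤n {suc n} q = +-mono-≤ (fromBool≤1 (q zero)) (count≤n (λ u → q (suc u)))

count-split : ∀ {n} (a q : Fin n → Bool) →
  count q ≡ count (λ u → a u ∧ q u) + count (λ u → not (a u) ∧ q u)
count-split a q = trans (sum-cong-≗ (λ u → split (a u) (q u)))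
                        (∑-distrib-+ (λ u → fromBool (a u ∧ q u)) (λ u → fromBool (not (a u) ∧ q u)))
  where
  split : ∀ x y → fromBool y ≡ fromBool (x ∧ y) + fromBool (not x ∧ y)
  split true  y = sym (+-identityʳ _)
  split false y = refl

count-∧<count⇔ : ∀ {n} (a q : Fin n → Bool) →
  count (λ u → a u ∧ q u) < count q ⇔ ∃ λ u → a u ≡ false × T (q u)
count-∧<count⇔ a q = mk⇔ to from
  where
  kept   = count (λ u → a u ∧ q u)
  missed = count (λ u → not (a u) ∧ q u)

  missed-positive : ∀ x y → 0 < fromBool (not x ∧ y) → x ≡ false × T y
  missed-positive false true _ = refl , _

  missed-one : ∀ x y → x ≡ false → T y → 0 < fromBool (not x ∧ y)
  missed-one false true _ _ = s≤s z≤n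

  to : kept < count q → ∃ λ u → a u ≡ false × T (q u)
  to kept<q with sum-positive (λ u → fromBool (not (a u) ∧ q u)) (+-cancelˡ-< kept 0 missed (begin-strict
    kept + 0      ≡⟨ +-identityʳ kept ⟩
    kept          <⟨ kept<q ⟩
    count q       ≡⟨ count-split a q ⟩
    kept + missed ∎))
    where open ≤-Reasoning
  ... | u , positive = u , missed-positive (a u) (q u) positive

  from : (∃ λ u → a u ≡ false × T (q u)) → kept < count q
  from (u , au≡false , Tqu) = begin-strict
    kept          ≡⟨ +-identityʳ kept ⟨
    kept + 0      <⟨ +-monoʳ-< kept (≤-trans (missed-one (a u) (q u) au≡false Tqu) (≤-sum _ u)) ⟩
    kept + missed ≡⟨ count-split a q ⟨
    count q       ∎
    where open ≤-Reasoning

true≢false : true ≢ false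
true≢false ()

countPair-∷ : ∀ {n} (u v : Fin n) e L → countPair u v (e ∷ L) ≡ countPair u v (e ∷ []) + countPair u v L
countPair-∷ u v (a , b) L with a ≟F u | b ≟F v | a ≟F v | b ≟F u
... | yes _ | yes _ | _     | _     = refl
... | yes _ | no _  | yes _ | yes _ = refl
... | yes _ | no _  | yes _ | no _  = refl
... | yes _ | no _  | no _  | _     = refl
... | no _  | _     | yes _ | yes _ = refl
... | no _  | _     | yes _ | no _  = refl
... | no _  | _     | no _  | _     = refl

module _ {n} (G : Graph n) where

  countPair-non-edge : ∀ {u v} a b → Adj G a b → adj G u v ≡ false → countPair u v ((a , b) ∷ []) ≡ 0
  countPair-non-edge {u} {v} a b ab uv with a ≟F u | b ≟F v | a ≟F v | b ≟F u
  ... | yes refl | yes refl | _        | _        = ⊥-elim (true≢false (trans (sym ab) uv))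
  ... | yes _    | no _     | yes refl | yes refl = ⊥-elim (true≢false (trans (sym ab) (trans (Graph.sym G _ _) uv)))
  ... | yes _    | no _     | yes _    | no _     = refl
  ... | yes _    | no _     | no _     | _        = refl
  ... | no _     | _        | yes refl | yes refl = ⊥-elim (true≢false (trans (sym ab) (trans (Graph.sym G _ _) uv)))
  ... | no _     | _        | yes _    | no _     = refl
  ... | no _     | _        | no _     | _        = refl

  countPair-stream : ∀ {L} → IsStreamOf G L → ∀ u v → countPair u v L ≡ fromBool (adj G u v)
  countPair-stream {L} (edges , once) u v with adj G u v in uv
  ... | true  = once u v uv
  ... | false = absent L edges
    where
    absent : ∀ L → (∀ e → e ∈ L → Adj G (proj₁ e) (proj₂ e)) → countPair u v L ≡ 0
    absent []            _     = refl
    absent ((a , b) ∷ L) edges = trans (countPair-∷ u v (a , b) L)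
      (cong₂ _+_ (countPair-non-edge a b (edges _ (here refl)) uv) (absent L (λ e e∈L → edges e (there e∈L))))

-- Only memory is accounted for, so an item's effect on a counter may be computed by brute force.
incidence : ∀ {n} → (Fin n → Fin n → Bool) → Fin n → Edge n → ℕ
incidence Q v e = sum (λ u → fromBool (Q v u) * countPair v u (e ∷ []))

incidences : ∀ {n} → (Fin n → Fin n → Bool) → Fin n → List (Edge n) → ℕ
incidences Q v []      = 0
incidences Q v (e ∷ L) = incidence Q v e + incidences Q v L

incidences≡∑ : ∀ {n} (Q : Fin n → Fin n → Bool) v L →
  incidences Q v L ≡ sum (λ u → fromBool (Q v u) * countPair v u L)
incidences≡∑ {n} Q v [] = sym (trans (sum-cong-≗ (λ u → *-zeroʳ (fromBool (Q v u)))) (sum-replicate-zero n))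
incidences≡∑ Q v (e ∷ L) = begin
  incidence Q v e + incidences Q v L
    ≡⟨ cong (incidence Q v e +_) (incidences≡∑ Q v L) ⟩
  sum (λ u → q u * countPair v u (e ∷ [])) + sum (λ u → q u * countPair v u L)
    ≡⟨ ∑-distrib-+ (λ u → q u * countPair v u (e ∷ [])) (λ u → q u * countPair v u L) ⟨
  sum (λ u → q u * countPair v u (e ∷ []) + q u * countPair v u L)
    ≡⟨ sum-cong-≗ (λ u → trans (cong (q u *_) (countPair-∷ v u e L)) (*-distribˡ-+ (q u) _ _)) ⟨
  sum (λ u → q u * countPair v u (e ∷ L))
    ∎
  where
  open ≡-Reasoning
  q : Fin _ → ℕ
  q u = fromBool (Q v u)

fromBool-∧ : ∀ x y → fromBool x * fromBool y ≡ fromBool (y ∧ x)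
fromBool-∧ true  true  = refl
fromBool-∧ true  false = refl
fromBool-∧ false true  = refl
fromBool-∧ false false = refl

incidences-stream : ∀ {n} (G : Graph n) {L} → IsStreamOf G L → ∀ Q v →
  incidences Q v L ≡ count (λ u → adj G v u ∧ Q v u)
incidences-stream G {L} stream Q v = trans (incidences≡∑ Q v L) (sum-cong-≗ λ u →
  trans (cong (fromBool (Q v u) *_) (countPair-stream G stream v u)) (fromBool-∧ (Q v u) (adj G v u)))

NonAdj : ∀ {n} → Graph n → Fin n → Fin n → Set
NonAdj G u v = adj G u v ≡ false

nonAdjIn? : ∀ {n} (G : Graph n) v (q : Fin n → Bool) → Dec (∃ λ u → NonAdj G v u × T (q u))
nonAdjIn? G v q = any? λ u → (adj G v u ≟B false) ×-dec T? (q u)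

-- Each round asks every vertex v whether query(v) holds a non-neighbour of v (v itself counts).
record QueryAlg (n : ℕ) (Out : Set) : Set₁ where
  field
    State         : Set
    width         : ℕ
    registers     : State → Vec ℕ width
    fromRegisters : Vec ℕ width → State
    fromRegisters-registers : ∀ s → fromRegisters (registers s) ≡ s
    start         : State
    query         : State → Fin n → Fin n → Bool
    next          : State → Vec Bool n → State ⊎ Out

module _ {n Out} (M : QueryAlg n Out) where
  open QueryAlg M

  answers : Graph n → State → Vec Bool n
  answers G s = tabulate λ v → does (nonAdjIn? G v (query s v))

  answer-reflects : ∀ G s v → Reflects (∃ λ u → NonAdj G v u × T (query s v u)) (lookup (answers G s) v)
  answer-reflects G s v = subst (Reflects _) (sym (lookup∘tabulate _ v)) (proof (nonAdjIn? G v (query s v)))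

module _ {n Out} (M : QueryAlg n Out) (z : ℕ) where
  open QueryAlg M

  wrapState : State → State
  wrapState s = fromRegisters (map (wrap z) (registers s))

  wrapState-bounded : ∀ s → All (_< 2 ^ z) (registers s) → wrapState s ≡ s
  wrapState-bounded s bounded = trans (cong fromRegisters (map-wrap-bounded z bounded)) (fromRegisters-registers s)

  -- Registers are reduced modulo 2^z every round, as in the bit-level simulation below.
  runQuery : Graph n → ℕ → State → Maybe Out
  runQuery G zero    s = nothing
  runQuery G (suc p) s = [ runQuery G p , just ]′ (next (wrapState s) (answers M G (wrapState s)))

  runQuery-bounded : ∀ G p s → All (_< 2 ^ z) (registers s) →
    runQuery G (suc p) s ≡ [ runQuery G p , just ]′ (next s (answers M G s))
  runQuery-bounded G p s bounded =
    cong (λ s′ → [ runQuery G p , just ]′ (next s′ (answers M G s′))) (wrapState-bounded s bounded)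

  memory : ℕ
  memory = width * z + n * z

  load : State → (Fin n → ℕ) → Mem memory
  load s c = encodeRegs z (registers s) ++ encodeRegs z (tabulate c)

  stateOf : Mem memory → State
  stateOf m = fromRegisters (decodeRegs z width (take (width * z) m))

  countersOf : Mem memory → Vec ℕ n
  countersOf m = decodeRegs z n (drop (width * z) m)

  streamAlg : StreamAlg n memory Out
  streamAlg = record
    { init    = load start (λ _ → 0)
    ; step    = λ m e → take (width * z) m ++
                  encodeRegs z (tabulate λ v → lookup (countersOf m) v + incidence (query (stateOf m)) v e)
    ; endPass = λ m → map₁ (λ s → load s (λ _ → 0))
                  (next (stateOf m) (tabulate λ v → does (lookup (countersOf m) v <? count (query (stateOf m) v))))
    }

  stateOf-load : ∀ s c → stateOf (load s c) ≡ wrapState s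
  stateOf-load s c = trans (cong (λ bs → fromRegisters (decodeRegs z width bs)) (take-++ (width * z) _ _))
                            (cong fromRegisters (decodeRegs-encodeRegs z (registers s)))

  countersOf-load : ∀ s c → (∀ v → c v < 2 ^ z) → countersOf (load s c) ≡ tabulate c
  countersOf-load s c c<2^z = begin
    decodeRegs z n (drop (width * z) (load s c)) ≡⟨ cong (decodeRegs z n) (drop-++ (width * z) _ _) ⟩
    decodeRegs z n (encodeRegs z (tabulate c))   ≡⟨ decodeRegs-encodeRegs z (tabulate c) ⟩
    map (wrap z) (tabulate c)                    ≡⟨ map-wrap-bounded z (tabulate⁺ c<2^z) ⟩
    tabulate c                                   ∎
    where open ≡-Reasoning

  step-load : ∀ s c e → (∀ v → c v < 2 ^ z) →
    StreamAlg.step streamAlg (load s c) e ≡ load s (λ v → c v + incidence (query (wrapState s)) v e)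
  step-load s c e c<2^z = cong₂ _++_ (take-++ (width * z) _ _) (cong (encodeRegs z) (tabulate-cong λ v →
    trans (cong₂ (λ cs s′ → lookup cs v + incidence (query s′) v e) (countersOf-load s c c<2^z) (stateOf-load s c))
          (cong (_+ _) (lookup∘tabulate c v))))

  runPass-load : ∀ s c L → (∀ v → c v + incidences (query (wrapState s)) v L < 2 ^ z) →
    runPass streamAlg (load s c) L ≡ load s (λ v → c v + incidences (query (wrapState s)) v L)
  runPass-load s c [] bounded = cong (λ c′ → encodeRegs z (registers s) ++ encodeRegs z c′)
    (tabulate-cong λ v → sym (+-identityʳ (c v)))
  runPass-load s c (e ∷ L) bounded = begin
    runPass streamAlg (StreamAlg.step streamAlg (load s c) e) L
      ≡⟨ cong (λ m → runPass streamAlg m L) (step-load s c e c<2^z) ⟩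
    runPass streamAlg (load s c′) L
      ≡⟨ runPass-load s c′ L (λ v → subst (_< 2 ^ z) (sym (+-assoc (c v) _ _)) (bounded v)) ⟩
    load s (λ v → c′ v + incidences Q v L)
      ≡⟨ cong (λ c″ → encodeRegs z (registers s) ++ encodeRegs z c″) (tabulate-cong λ v → +-assoc (c v) _ _) ⟩
    load s (λ v → c v + incidences Q v (e ∷ L))
      ∎
    where
    open ≡-Reasoning
    Q = query (wrapState s)
    c′ : Fin n → ℕ
    c′ v = c v + incidence Q v e
    c<2^z : ∀ v → c v < 2 ^ z
    c<2^z v = ≤-<-trans (m≤m+n (c v) _) (bounded v)

  endPass-load : ∀ G s c → (∀ v → c v ≡ count (λ u → adj G v u ∧ query (wrapState s) v u)) → n < 2 ^ z →
    StreamAlg.endPass streamAlg (load s c) ≡ map₁ (λ s′ → load s′ (λ _ → 0)) (next (wrapState s) (answers M G (wrapState s)))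
  endPass-load G s c c≡count n<2^z = cong (map₁ (λ s′ → load s′ (λ _ → 0)))
    (cong₂ next (stateOf-load s c) (tabulate-cong λ v → begin
      does (lookup (countersOf (load s c)) v <? count (query (stateOf (load s c)) v))
        ≡⟨ cong₂ (λ cs s′ → does (lookup cs v <? count (query s′ v))) (countersOf-load s c c<2^z) (stateOf-load s c) ⟩
      does (lookup (tabulate c) v <? count (Q v))
        ≡⟨ cong (λ x → does (x <? count (Q v))) (trans (lookup∘tabulate c v) (c≡count v)) ⟩
      does (count (λ u → adj G v u ∧ Q v u) <? count (Q v))
        ≡⟨ does-⇔ (count-∧<count⇔ (adj G v) (Q v)) (count (λ u → adj G v u ∧ Q v u) <? count (Q v)) (nonAdjIn? G v (Q v)) ⟩
      does (nonAdjIn? G v (Q v))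
        ∎))
    where
    open ≡-Reasoning
    Q = query (wrapState s)
    c<2^z : ∀ v → c v < 2 ^ z
    c<2^z v = subst (_< 2 ^ z) (sym (c≡count v)) (≤-<-trans (count≤n _) n<2^z)

runFrom-suc : ∀ {n s Out} (A : StreamAlg n s Out) p m L →
  runFrom A (suc p) m L ≡ [ (λ m′ → runFrom A p m′ L) , just ]′ (StreamAlg.endPass A (runPass A m L))
runFrom-suc A p m L with StreamAlg.endPass A (runPass A m L)
... | inj₁ m′ = refl
... | inj₂ o  = refl

streamAlg-simulates : ∀ {n Out} (M : QueryAlg n Out) z (G : Graph n) L → IsStreamOf G L → n < 2 ^ z →
  ∀ p s → runFrom (streamAlg M z) p (load M z s (λ _ → 0)) L ≡ runQuery M z G p s
streamAlg-simulates M z G L stream n<2^z zero    s = refl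
streamAlg-simulates M z G L stream n<2^z (suc p) s = begin
  runFrom A (suc p) (load M z s (λ _ → 0)) L
    ≡⟨ runFrom-suc A p _ L ⟩
  continue (StreamAlg.endPass A (runPass A (load M z s (λ _ → 0)) L))
    ≡⟨ cong (λ m → continue (StreamAlg.endPass A m)) (runPass-load M z s (λ _ → 0) L counters-fit) ⟩
  continue (StreamAlg.endPass A (load M z s (λ v → 0 + incidences Q v L)))
    ≡⟨ cong continue (endPass-load M z G s _ degree n<2^z) ⟩
  continue (map₁ (λ s′ → load M z s′ (λ _ → 0)) (QueryAlg.next M (wrapState M z s) (answers M G (wrapState M z s))))
    ≡⟨ continue-load (QueryAlg.next M (wrapState M z s) (answers M G (wrapState M z s))) ⟩
  runQuery M z G (suc p) s
    ∎
  where
  open ≡-Reasoning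
  A = streamAlg M z
  Q = QueryAlg.query M (wrapState M z s)
  continue = [ (λ m′ → runFrom A p m′ L) , just ]′
  degree : ∀ v → 0 + incidences Q v L ≡ count (λ u → adj G v u ∧ Q v u)
  degree = incidences-stream G stream Q
  counters-fit : ∀ v → 0 + incidences Q v L < 2 ^ z
  counters-fit v = subst (_< 2 ^ z) (sym (degree v)) (≤-<-trans (count≤n _) n<2^z)
  continue-load : ∀ r → continue (map₁ (λ s′ → load M z s′ (λ _ → 0)) r) ≡ [ runQuery M z G p , just ]′ r
  continue-load (inj₁ s′) = streamAlg-simulates M z G L stream n<2^z p s′
  continue-load (inj₂ o)  = refl

data CoReach {n} (G : Graph n) : ℕ → Fin n → Fin n → Set where
  here : ∀ {r a} → CoReach G r a a
  _▹_  : ∀ {r a b c} → CoReach G r a b → CoAdj G b c → CoReach G (suc r) a c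

nonAdj-refl : ∀ {n} (G : Graph n) v → NonAdj G v v
nonAdj-refl G = irrefl G

nonAdj-sym : ∀ {n} (G : Graph n) {u v} → NonAdj G u v → NonAdj G v u
nonAdj-sym G {u} {v} uv = trans (Graph.sym G v u) uv

coAdj-sym : ∀ {n} (G : Graph n) {u v} → CoAdj G u v → CoAdj G v u
coAdj-sym G (u≢v , uv) = (λ v≡u → u≢v (sym v≡u)) , nonAdj-sym G uv

module _ {n} {G : Graph n} where

  coReach-suc : ∀ {r a b} → CoReach G r a b → CoReach G (suc r) a b
  coReach-suc here        = here
  coReach-suc (path ▹ bc) = coReach-suc path ▹ bc

  coReach-zero : ∀ {a b} → CoReach G 0 a b → a ≡ b
  coReach-zero here = refl

  _▹NonAdj_ : ∀ {r a u v} → CoReach G r a u → NonAdj G v u → CoReach G (suc r) a v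
  _▹NonAdj_ {u = u} {v} path vu with u ≟F v
  ... | yes refl = coReach-suc path
  ... | no u≢v   = path ▹ (u≢v , nonAdj-sym G vu)

  coReach⇒coConnected : ∀ {r a b} → CoReach G r a b → CoConnected G a b
  coReach⇒coConnected here        = ε
  coReach⇒coConnected (path ▹ bc) = coReach⇒coConnected path ◅◅ (bc ◅ ε)

narrow : ℕ → ℕ → Bool → ℕ
narrow e l b = if b then l else l + 2 ^ e

-- Binary search, for every v at once, for the least key v u over the u with R v u.
module MinSearch {n} (R : Fin n → Fin n → Set) (key : Fin n → Fin n → ℕ) where

  IsMin : Fin n → ℕ → Set
  IsMin v m = (∀ u → R v u → m ≤ key v u) × (∃ λ u → R v u × m ≡ key v u)

  Bracket : ℕ → Fin n → ℕ → Set
  Bracket e v l = (∀ u → R v u → l ≤ key v u) × (∃ λ u → R v u × key v u < l + 2 ^ e)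

  Below : ℕ → Fin n → ℕ → Set
  Below t v l = ∃ λ u → R v u × T ⌊ key v u <? l + 2 ^ t ⌋

  bracket-start : ∀ {e} v → R v v → key v v < 2 ^ e → Bracket e v 0
  bracket-start v rvv kvv<2^e = (λ _ _ → z≤n) , v , rvv , kvv<2^e

  bracket-narrow : ∀ {e v l b} → Bracket (suc e) v l → Reflects (Below e v l) b → Bracket e v (narrow e l b)
  bracket-narrow (lower , _) (ofʸ (u , ru , below)) = lower , u , ru , toWitness below
  bracket-narrow {e} {v} {l} (lower , u , ru , k<l+2^1+e) (ofⁿ ¬below) = raised , u , ru , k<l+2^e+2^e
    where
    raised : ∀ u → R v u → l + 2 ^ e ≤ key v u
    raised u ru = ≮⇒≥ λ k<l+2^e → ¬below (u , ru , fromWitness k<l+2^e)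
    k<l+2^e+2^e : key v u < l + 2 ^ e + 2 ^ e
    k<l+2^e+2^e = subst (key v u <_) (trans (cong (λ x → l + (2 ^ e + x)) (+-identityʳ (2 ^ e))) (sym (+-assoc l _ _))) k<l+2^1+e

  bracket-zero : ∀ {v l} → Bracket 0 v l → IsMin v l
  bracket-zero {v} {l} (lower , u , ru , k<l+1) =
    lower , u , ru , ≤-antisym (lower u ru) (≤-pred (subst (key v u <_) (+-comm l 1) k<l+1))

toℕ-mod : ∀ {x n} .{{_ : NonZero n}} → x < n → toℕ (x mod n) ≡ x
toℕ-mod {x} {n} x<n = trans (toℕ-fromℕ< (m%n<n x n)) (m<n⇒m%n≡m x<n)

data Task : Set where
  labels parents : Task

data Phase : Set where
  search : Task → Phase
  bfs    : Phase

phaseCode : Phase → ℕ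
phaseCode (search labels)  = 0
phaseCode (search parents) = 1
phaseCode bfs              = 2

codePhase : ℕ → Phase
codePhase 0 = search labels
codePhase 1 = search parents
codePhase _ = bfs

codePhase-phaseCode : ∀ φ → codePhase (phaseCode φ) ≡ φ
codePhase-phaseCode (search labels)  = refl
codePhase-phaseCode (search parents) = refl
codePhase-phaseCode bfs              = refl

module Algorithm (n₀ k W′ : ℕ) where

  n : ℕ
  n = suc n₀

  W : ℕ
  W = suc W′

  -- k + 1 labelling rounds of W passes, k + 1 BFS passes, and W passes for the parents.
  passes : ℕ
  passes = suc k * W + (suc k + W)

  record State : Set where
    constructor state
    field
      phase    : Phase
      round    : ℕ
      exponent : ℕ
      target   : ℕ
      values   : Vec ℕ n
      lower    : Vec ℕ n

  registers : State → Vec ℕ (4 + (n + n))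
  registers (state φ r e y val lo) = phaseCode φ ∷ r ∷ e ∷ y ∷ val ++ lo

  fromRegisters : Vec ℕ (4 + (n + n)) → State
  fromRegisters (c ∷ r ∷ e ∷ y ∷ rest) = state (codePhase c) r e y (take n rest) (drop n rest)

  fromRegisters-registers : ∀ s → fromRegisters (registers s) ≡ s
  fromRegisters-registers (state φ r e y val lo)
    rewrite codePhase-phaseCode φ | take-++ n val lo | drop-++ n val lo = refl

  zeros : Vec ℕ n
  zeros = replicate n 0

  unreached : ℕ
  unreached = suc (suc k)

  vertex : ℕ → Fin n
  vertex x = x mod n

  -- n exceeds every vertex index, so a vertex that is not closer never wins the minimum.
  key : Task → Vec ℕ n → Fin n → Fin n → ℕ
  key labels  val v u = lookup val u
  key parents D   v u = if ⌊ lookup D u <? lookup D v ⌋ then toℕ u else n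

  query : State → Fin n → Fin n → Bool
  query (state (search t) r e y val lo) v u = ⌊ key t val v u <? lookup lo v + 2 ^ e ⌋
  query (state bfs        r e y D   lo) v u = ⌊ lookup D u ≤? r ⌋

  narrowAll : ℕ → Vec ℕ n → Vec Bool n → Vec ℕ n
  narrowAll e lo ans = tabulate λ v → narrow e (lookup lo v) (lookup ans v)

  relaxed : ℕ → ℕ → Bool → ℕ
  relaxed r d b = if ⌊ d ≤? r ⌋ then d else if b then suc r else d

  relax : ℕ → Vec ℕ n → Vec Bool n → Vec ℕ n
  relax r D ans = tabulate λ v → relaxed r (lookup D v) (lookup ans v)

  source : ℕ → Vec ℕ n
  source x = tabulate λ v → if ⌊ toℕ v ≟ x ⌋ then 0 else unreached

  path : ℕ → Vec ℕ n → Fin (k + 2) → Fin n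
  path y m j = fold (vertex y) (λ v → vertex (lookup m v)) (suc k ∸ toℕ j)

  checkLabels : (val m : Vec ℕ n) → Dec (∃ λ v → lookup m v ≢ lookup val v) → State ⊎ Output n k
  checkLabels val m (no _)        = inj₂ (inj₁ λ v → vertex (lookup val v))
  checkLabels val m (yes (y , _)) = inj₁ (state bfs 0 0 (toℕ y) (source (lookup m y)) zeros)

  differs? : (val m : Vec ℕ n) → Dec (∃ λ v → lookup m v ≢ lookup val v)
  differs? val m = any? λ v → ¬? (lookup m v ≟ lookup val v)

  finish : Task → ℕ → ℕ → Vec ℕ n → Vec ℕ n → State ⊎ Output n k
  finish labels r y val m with r <? k
  ... | yes _ = inj₁ (state (search labels) (suc r) W′ y m zeros)
  ... | no _  = checkLabels val m (differs? val m)
  finish parents r y D m = inj₂ (inj₂ (path y m))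

  next : State → Vec Bool n → State ⊎ Output n k
  next (state (search t) r zero    y val lo) ans = finish t r y val (narrowAll 0 lo ans)
  next (state (search t) r (suc e) y val lo) ans = inj₁ (state (search t) r e y val (narrowAll (suc e) lo ans))
  next (state bfs r e y D lo) ans with r <? k
  ... | yes _ = inj₁ (state bfs (suc r) e y (relax r D ans) lo)
  ... | no _  = inj₁ (state (search parents) 0 W′ y (relax r D ans) zeros)

  algorithm : QueryAlg n (Output n k)
  algorithm = record
    { State = State
    ; width = 4 + (n + n)
    ; registers = registers
    ; fromRegisters = fromRegisters
    ; fromRegisters-registers = fromRegisters-registers
    ; start = state (search labels) 0 W′ 0 (tabulate toℕ) zeros
    ; query = query
    ; next = next
    }

n<2^n : ∀ x → x < 2 ^ x
n<2^n zero    = s≤s z≤n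
n<2^n (suc x) = begin-strict
  suc x           <⟨ s≤s (n<2^n x) ⟩
  suc (2 ^ x)     ≤⟨ +-monoˡ-≤ (2 ^ x) (m^n>0 2 x) ⟩
  2 ^ x + 2 ^ x   ≡⟨ cong (2 ^ x +_) (+-identityʳ (2 ^ x)) ⟨
  2 ^ suc x       ∎
  where open ≤-Reasoning

module Correctness (n₀ k W′ Z : ℕ) (G : Graph (suc n₀))
                   (n<2^W : suc n₀ < 2 ^ suc W′) (W≤Z : suc W′ ≤ Z) (∞≤Z : 2 + k ≤ Z) where
  open Algorithm n₀ k W′

  runQ : ℕ → State → Maybe (Output n k)
  runQ = runQuery algorithm Z G

  ans : State → Vec Bool n
  ans = answers algorithm G

  Fits : ℕ → Set
  Fits x = x < 2 ^ Z

  ≤Z⇒fits : ∀ {x} → x ≤ Z → Fits x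
  ≤Z⇒fits x≤Z = ≤-<-trans x≤Z (n<2^n Z)

  <2^W⇒fits : ∀ {x} → x < 2 ^ W → Fits x
  <2^W⇒fits x<2^W = <-≤-trans x<2^W (^-monoʳ-≤ 2 W≤Z)

  ≤∞⇒fits : ∀ {x} → x ≤ unreached → Fits x
  ≤∞⇒fits x≤∞ = ≤Z⇒fits (≤-trans x≤∞ ∞≤Z)

  ≤k⇒fits : ∀ {x} → x ≤ k → Fits x
  ≤k⇒fits x≤k = ≤∞⇒fits (≤-trans x≤k (m≤n+m k 2))

  <n⇒fits : ∀ {x} → x < n → Fits x
  <n⇒fits x<n = <2^W⇒fits (<-trans x<n n<2^W)

  runQ-step : ∀ {φ r e y val lo} p → Fits (phaseCode φ) → Fits r → Fits e → Fits y →
    (∀ v → Fits (lookup val v)) → (∀ v → Fits (lookup lo v)) →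
    runQ (suc p) (state φ r e y val lo) ≡ [ runQ p , just ]′ (next (state φ r e y val lo) (ans (state φ r e y val lo)))
  runQ-step {val = val} {lo} p φ< r< e< y< val< lo< =
    runQuery-bounded algorithm Z G p _ (φ< ∷ r< ∷ e< ∷ y< ∷ ++⁺ (lookup⁻ {xs = val} val<) (lookup⁻ {xs = lo} lo<))

  module Search (t : Task) (r y : ℕ) (val : Vec ℕ n) (r≤k : r ≤ k) (y<n : y < n)
                (val-fits : ∀ v → Fits (lookup val v)) (key<2^W : ∀ v → key t val v v < 2 ^ W) where
    open MinSearch (NonAdj G) (key t val)

    bracket-start-W : ∀ v → Bracket W v (lookup zeros v)
    bracket-start-W v = subst (Bracket W v) (sym (lookup-replicate v 0)) (bracket-start {e = W} v (nonAdj-refl G v) (key<2^W v))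

    searching : ℕ → Vec ℕ n → State
    searching e lo = state (search t) r e y val lo

    narrowed : ∀ e lo → (∀ v → Bracket (suc e) v (lookup lo v)) →
      ∀ v → Bracket e v (lookup (narrowAll e lo (ans (searching e lo))) v)
    narrowed e lo brackets v =
      subst (Bracket e v) (sym (lookup∘tabulate (λ u → narrow e (lookup lo u) (lookup (ans (searching e lo)) u)) v))
        (bracket-narrow {e = e} (brackets v) (answer-reflects algorithm G (searching e lo) v))

    search-step : ∀ e p lo → e < W → (∀ v → Bracket (suc e) v (lookup lo v)) →
      runQ (suc p) (searching e lo) ≡ [ runQ p , just ]′ (next (searching e lo) (ans (searching e lo)))
    search-step e p lo e<W brackets = runQ-step p (≤∞⇒fits (task≤∞ t)) (≤k⇒fits r≤k) (<2^W⇒fits (<-trans e<W (n<2^n W)))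
      (<n⇒fits y<n) val-fits (λ v → <2^W⇒fits (≤-<-trans (proj₁ (brackets v) v (nonAdj-refl G v)) (key<2^W v)))
      where
      task≤∞ : ∀ t → phaseCode (search t) ≤ unreached
      task≤∞ labels  = z≤n
      task≤∞ parents = s≤s z≤n

    search-run : ∀ e p lo → e < W → (∀ v → Bracket (suc e) v (lookup lo v)) →
      ∃ λ m → (∀ v → IsMin v (lookup m v)) × runQ (suc e + p) (searching e lo) ≡ [ runQ p , just ]′ (finish t r y val m)
    search-run zero    p lo e<W brackets =
      narrowAll 0 lo (ans (searching 0 lo)) , (λ v → bracket-zero (narrowed 0 lo brackets v)) , search-step 0 p lo e<W brackets
    search-run (suc e) p lo e<W brackets with search-run e p _ (<-trans (n<1+n e) e<W) (narrowed (suc e) lo brackets)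
    ... | m , isMin , run≡ = m , isMin , trans (search-step (suc e) (suc e + p) lo e<W brackets) run≡

  IsLeast : Task → Vec ℕ n → Fin n → ℕ → Set
  IsLeast t val = MinSearch.IsMin (NonAdj G) (key t val)

  LeastWithin : ℕ → Fin n → ℕ → Set
  LeastWithin r v x = (∃ λ a → toℕ a ≡ x × CoReach G r a v) × (∀ a → CoReach G r a v → x ≤ toℕ a)

  leastWithin-zero : ∀ v → LeastWithin 0 v (lookup (tabulate toℕ) v)
  leastWithin-zero v = (v , sym (lookup∘tabulate toℕ v) , here) ,
    λ a a⇝v → subst (λ w → lookup (tabulate toℕ) v ≤ toℕ w) (sym (coReach-zero a⇝v))
                     (≤-reflexive (lookup∘tabulate toℕ v))

  leastWithin-suc : ∀ {r val v x} → (∀ u → LeastWithin r u (lookup val u)) → IsLeast labels val v x → LeastWithin (suc r) v x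
  leastWithin-suc {r} {val} {v} {x} least (x≤ , u , vu , x≡) = reached , minimal
    where
    reached : ∃ λ a → toℕ a ≡ x × CoReach G (suc r) a v
    reached with proj₁ (least u)
    ... | a , a≡ , a⇝u = a , trans a≡ (sym x≡) , a⇝u ▹NonAdj vu
    minimal : ∀ a → CoReach G (suc r) a v → x ≤ toℕ a
    minimal a here              = ≤-trans (x≤ a (nonAdj-refl G a)) (proj₂ (least a) a here)
    minimal a (_▹_ {b = b} a⇝b bv) = ≤-trans (x≤ b (nonAdj-sym G (proj₂ bv))) (proj₂ (least b) a a⇝b)

  leastWithin<n : ∀ {r v x} → LeastWithin r v x → x < n
  leastWithin<n ((a , a≡ , _) , _) = subst (_< n) a≡ (toℕ<n a)

  finish-labels-< : ∀ {r y val m} → r < k → finish labels r y val m ≡ inj₁ (state (search labels) (suc r) W′ y m zeros)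
  finish-labels-< {r} r<k with r <? k
  ... | yes _  = refl
  ... | no r≮k = ⊥-elim (r≮k r<k)

  finish-labels-k : ∀ {y val m} → finish labels k y val m ≡ checkLabels val m (differs? val m)
  finish-labels-k with k <? k
  ... | yes k<k = ⊥-elim (<-irrefl refl k<k)
  ... | no _    = refl

  remaining⇒< : ∀ {t r} → suc t + r ≡ k → r < k
  remaining⇒< {t} {r} t+r≡k = subst (r <_) t+r≡k (s≤s (m≤n+m r t))

  labels-round : ∀ r val q → r ≤ k → (∀ v → LeastWithin r v (lookup val v)) →
    ∃ λ m → (∀ v → IsLeast labels val v (lookup m v)) ×
      runQ (W + q) (state (search labels) r W′ 0 val zeros) ≡ [ runQ q , just ]′ (finish labels r 0 val m)
  labels-round r val q r≤k least = search-run W′ q zeros ≤-refl bracket-start-W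
    where open Search labels r 0 val r≤k (s≤s z≤n) (λ v → <n⇒fits (leastWithin<n (least v)))
                                                    (λ v → <-trans (leastWithin<n (least v)) n<2^W)

  labels-run : ∀ t r val → t + r ≡ k → (∀ v → LeastWithin r v (lookup val v)) → ∀ p →
    ∃ λ val′ → ∃ λ m → (∀ v → LeastWithin k v (lookup val′ v)) × (∀ v → IsLeast labels val′ v (lookup m v)) ×
      runQ (suc t * W + p) (state (search labels) r W′ 0 val zeros) ≡ [ runQ p , just ]′ (checkLabels val′ m (differs? val′ m))
  labels-run zero r val refl least p with labels-round k val p ≤-refl least
  ... | m , isMin , run≡ = val , m , least , isMin ,
    trans (cong (λ f → runQ f (state (search labels) k W′ 0 val zeros)) (+-assoc W 0 p))
          (trans run≡ (cong [ runQ p , just ]′ finish-labels-k))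
  labels-run (suc t) r val t+r≡k least p with labels-round r val (suc t * W + p) (<⇒≤ (remaining⇒< t+r≡k)) least
  ... | m , isMin , run≡ with labels-run t (suc r) m (trans (+-suc t r) t+r≡k) (λ v → leastWithin-suc {r} {val} least (isMin v)) p
  ...   | val′ , m′ , least′ , isMin′ , run′≡ = val′ , m′ , least′ , isMin′ , (begin
    runQ (suc (suc t) * W + p) (state (search labels) r W′ 0 val zeros)
      ≡⟨ cong (λ f → runQ f (state (search labels) r W′ 0 val zeros)) (+-assoc W (suc t * W) p) ⟩
    runQ (W + (suc t * W + p)) (state (search labels) r W′ 0 val zeros)
      ≡⟨ run≡ ⟩
    [ runQ (suc t * W + p) , just ]′ (finish labels r 0 val m)
      ≡⟨ cong [ runQ (suc t * W + p) , just ]′ (finish-labels-< (remaining⇒< t+r≡k)) ⟩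
    runQ (suc t * W + p) (state (search labels) (suc r) W′ 0 m zeros)
      ≡⟨ run′≡ ⟩
    [ runQ p , just ]′ (checkLabels val′ m′ (differs? val′ m′))
      ∎)
    where open ≡-Reasoning

  labelling-correct : ∀ {val m} → (∀ v → LeastWithin k v (lookup val v)) → (∀ v → IsLeast labels val v (lookup m v)) →
    (∀ v → lookup m v ≡ lookup val v) → Correct k G (inj₁ λ v → vertex (lookup val v))
  labelling-correct {val} {m} least isMin stable u v = mk⇔ to from
    where
    toℕ-vertex : ∀ w → toℕ (vertex (lookup val w)) ≡ lookup val w
    toℕ-vertex w = toℕ-mod (leastWithin<n (least w))

    to : vertex (lookup val u) ≡ vertex (lookup val v) → CoConnected G u v
    to same with proj₁ (least u) | proj₁ (least v)
    ... | a , a≡ , a⇝u | b , b≡ , b⇝v with toℕ-injective (trans a≡ (trans (sym (toℕ-vertex u))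
                                           (trans (cong toℕ same) (trans (toℕ-vertex v) (sym b≡)))))
    ...   | refl = reverse (coAdj-sym G) (coReach⇒coConnected a⇝u) ◅◅ coReach⇒coConnected b⇝v

    co-edge : ∀ {x z} → CoAdj G x z → lookup val x ≡ lookup val z
    co-edge {x} {z} (_ , xz) = ≤-antisym (subst (_≤ lookup val z) (stable x) (proj₁ (isMin x) z xz))
                                         (subst (_≤ lookup val x) (stable z) (proj₁ (isMin z) x (nonAdj-sym G xz)))

    constant : ∀ {x z} → CoConnected G x z → lookup val x ≡ lookup val z
    constant ε         = refl
    constant (xy ◅ yz) = trans (co-edge xy) (constant yz)

    from : CoConnected G u v → vertex (lookup val u) ≡ vertex (lookup val v)
    from u~v = cong vertex (constant u~v)

  up-to-suc : ∀ {r} {P : ℕ → Set} → (∀ i → i ≤ r → P i) → P (suc r) → ∀ i → i ≤ suc r → P i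
  up-to-suc below at i i≤1+r with m≤n⇒m<n∨m≡n i≤1+r
  ... | inj₁ (s≤s i≤r) = below i i≤r
  ... | inj₂ refl      = at

  next-bfs-< : ∀ {r e y D lo ans} → r < k → next (state bfs r e y D lo) ans ≡ inj₁ (state bfs (suc r) e y (relax r D ans) lo)
  next-bfs-< {r} r<k with r <? k
  ... | yes _  = refl
  ... | no r≮k = ⊥-elim (r≮k r<k)

  next-bfs-k : ∀ {e y D lo ans} → next (state bfs k e y D lo) ans ≡ inj₁ (state (search parents) 0 W′ y (relax k D ans) zeros)
  next-bfs-k with k <? k
  ... | yes k<k = ⊥-elim (<-irrefl refl k<k)
  ... | no _    = refl

  zeros-fit : ∀ v → Fits (lookup zeros v)
  zeros-fit v = subst Fits (sym (lookup-replicate v 0)) (≤k⇒fits z≤n)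

  module BFS (a : Fin n) (y : ℕ) (y<n : y < n) where

    Dist : ℕ → Fin n → ℕ → Set
    Dist r v d = (∀ i → i ≤ r → (d ≤ i ⇔ CoReach G i a v)) × (d ≤ r ⊎ d ≡ unreached)

    dist-zero : ∀ v → Dist 0 v (lookup (source (toℕ a)) v)
    dist-zero v = subst (Dist 0 v) (sym (lookup∘tabulate (λ w → if ⌊ toℕ w ≟ toℕ a ⌋ then 0 else unreached) v))
                        (initial (toℕ v ≟ toℕ a))
      where
      initial : (v≟a : Dec (toℕ v ≡ toℕ a)) → Dist 0 v (if ⌊ v≟a ⌋ then 0 else unreached)
      initial (yes v≡a) with toℕ-injective v≡a
      ... | refl = (λ { _ z≤n → mk⇔ (λ _ → here) (λ _ → z≤n) }) , inj₁ z≤n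
      initial (no v≢a)  = (λ { _ z≤n → mk⇔ (λ ()) (λ a⇝v → ⊥-elim (v≢a (cong toℕ (sym (coReach-zero a⇝v))))) }) ,
                          inj₂ refl

    dist-relaxed : ∀ {r D v b} → r ≤ k → (∀ u → Dist r u (lookup D u)) →
      Reflects (∃ λ u → NonAdj G v u × T ⌊ lookup D u ≤? r ⌋) b → Dist (suc r) v (relaxed r (lookup D v) b)
    dist-relaxed {r} {D} {v} r≤k dists reflects with lookup D v ≤? r
    ... | yes dv≤r = up-to-suc (proj₁ (dists v)) (mk⇔ (λ _ → coReach-suc reached) (λ _ → dv≤1+r)) , inj₁ dv≤1+r
      where
      dv≤1+r = ≤-trans dv≤r (n≤1+n r)
      reached = Equivalence.to (proj₁ (dists v) r ≤-refl) dv≤r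
    ... | no dv≰r with reflects
    ...   | ofʸ (u , vu , du≤r) = up-to-suc earlier (mk⇔ (λ _ → reached) (λ _ → ≤-refl)) , inj₁ ≤-refl
      where
      earlier : ∀ i → i ≤ r → suc r ≤ i ⇔ CoReach G i a v
      earlier i i≤r = mk⇔ (λ 1+r≤i → ⊥-elim (1+n≰n (≤-trans 1+r≤i i≤r)))
                          (λ a⇝v → ⊥-elim (dv≰r (≤-trans (Equivalence.from (proj₁ (dists v) i i≤r) a⇝v) i≤r)))
      reached : CoReach G (suc r) a v
      reached = Equivalence.to (proj₁ (dists u) r ≤-refl) (toWitness du≤r) ▹NonAdj vu
    ...   | ofⁿ none = up-to-suc (proj₁ (dists v)) (mk⇔ (λ dv≤1+r → ⊥-elim (too-far dv≤1+r)) (λ a⇝v → ⊥-elim (dv≰r (within a⇝v)))) ,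
                       inj₂ dv≡∞
      where
      dv≡∞ : lookup D v ≡ unreached
      dv≡∞ with proj₂ (dists v)
      ... | inj₁ dv≤r = ⊥-elim (dv≰r dv≤r)
      ... | inj₂ dv≡∞ = dv≡∞
      too-far : ¬ lookup D v ≤ suc r
      too-far dv≤1+r = 1+n≰n (≤-trans (subst (_≤ suc r) dv≡∞ dv≤1+r) (s≤s r≤k))
      within : CoReach G (suc r) a v → lookup D v ≤ r
      within here                    = Equivalence.from (proj₁ (dists a) r ≤-refl) here
      within (_▹_ {b = b} a⇝b (_ , bv)) =
        ⊥-elim (none (b , nonAdj-sym G bv , fromWitness (Equivalence.from (proj₁ (dists b) r ≤-refl) a⇝b)))

    Dists : ℕ → Vec ℕ n → Set
    Dists r D = ∀ v → Dist r v (lookup D v)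

    dists-fit : ∀ {r D} → r ≤ suc k → Dists r D → ∀ v → Fits (lookup D v)
    dists-fit r≤1+k dists v with proj₂ (dists v)
    ... | inj₁ dv≤r = ≤∞⇒fits (≤-trans dv≤r (≤-trans r≤1+k (n≤1+n (suc k))))
    ... | inj₂ dv≡∞ = ≤∞⇒fits (≤-reflexive dv≡∞)

    bfs-step : ∀ r D p → r ≤ k → Dists r D →
      runQ (suc p) (state bfs r 0 y D zeros) ≡ [ runQ p , just ]′ (next (state bfs r 0 y D zeros) (ans (state bfs r 0 y D zeros)))
    bfs-step r D p r≤k dists = runQ-step {bfs} {r} {0} {y} {D} {zeros} p
      (≤∞⇒fits (m≤m+n 2 k)) (≤k⇒fits r≤k) (≤k⇒fits z≤n) (<n⇒fits y<n) (dists-fit {D = D} (≤-trans r≤k (n≤1+n k)) dists) zeros-fit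

    dists-relax : ∀ r D → r ≤ k → Dists r D → Dists (suc r) (relax r D (ans (state bfs r 0 y D zeros)))
    dists-relax r D r≤k dists v = subst (Dist (suc r) v)
      (sym (lookup∘tabulate (λ u → relaxed r (lookup D u) (lookup (ans (state bfs r 0 y D zeros)) u)) v))
      (dist-relaxed {D = D} r≤k dists (answer-reflects algorithm G (state bfs r 0 y D zeros) v))

    bfs-run : ∀ t r D → t + r ≡ k → Dists r D → ∀ p →
      ∃ λ D* → Dists (suc k) D* × runQ (suc t + p) (state bfs r 0 y D zeros) ≡ runQ p (state (search parents) 0 W′ y D* zeros)
    bfs-run zero r D refl dists p = relax k D (ans (state bfs k 0 y D zeros)) , dists-relax k D ≤-refl dists ,
      trans (bfs-step k D p ≤-refl dists) (cong [ runQ p , just ]′ next-bfs-k)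
    bfs-run (suc t) r D t+r≡k dists p
      with bfs-run t (suc r) (relax r D (ans (state bfs r 0 y D zeros))) (trans (+-suc t r) t+r≡k)
                   (dists-relax r D (<⇒≤ (remaining⇒< t+r≡k)) dists) p
    ... | D* , dists* , run≡ = D* , dists* ,
      trans (bfs-step r D (suc t + p) (<⇒≤ (remaining⇒< t+r≡k)) dists)
            (trans (cong [ runQ (suc t + p) , just ]′ (next-bfs-< (remaining⇒< t+r≡k))) run≡)

    key-self : ∀ D v → key parents D v v ≡ n
    key-self D v with lookup D v <? lookup D v
    ... | yes d<d = ⊥-elim (<-irrefl refl d<d)
    ... | no _    = refl

    key-closer : ∀ D {v u} → lookup D u < lookup D v → key parents D v u ≡ toℕ u
    key-closer D {v} {u} closer with lookup D u <? lookup D v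
    ... | yes _ = refl
    ... | no not-closer = ⊥-elim (not-closer closer)

    key<n : ∀ D {v u} → key parents D v u < n → lookup D u < lookup D v × key parents D v u ≡ toℕ u
    key<n D {v} {u} key<n with lookup D u <? lookup D v
    ... | yes closer = closer , refl
    ... | no _       = ⊥-elim (<-irrefl refl key<n)

    parents-run : ∀ D → Dists (suc k) D →
      ∃ λ m → (∀ v → IsLeast parents D v (lookup m v)) ×
        runQ W (state (search parents) 0 W′ y D zeros) ≡ just (inj₂ (path y m))
    parents-run D dists with search-run W′ 0 zeros ≤-refl bracket-start-W
      where open Search parents 0 y D z≤n y<n (dists-fit {D = D} ≤-refl dists) (λ v → subst (_< 2 ^ W) (sym (key-self D v)) n<2^W)
    ... | m , isMin , run≡ =
      m , isMin , trans (cong (λ e → runQ (suc e) (state (search parents) 0 W′ y D zeros)) (sym (+-identityʳ W′))) run≡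

    module Path (D : Vec ℕ n) (dists : Dists (suc k) D) (m : Vec ℕ n)
                (isMin : ∀ v → IsLeast parents D v (lookup m v))
                (Dy≡1+k : lookup D (vertex y) ≡ suc k) where

      reach : ∀ {v i} → i ≤ suc k → lookup D v ≤ i → CoReach G i a v
      reach {v} {i} i≤1+k = Equivalence.to (proj₁ (dists v) i i≤1+k)

      bound : ∀ {v i} → i ≤ suc k → CoReach G i a v → lookup D v ≤ i
      bound {v} {i} i≤1+k = Equivalence.from (proj₁ (dists v) i i≤1+k)

      parent : Fin n → Fin n
      parent v = vertex (lookup m v)

      parent-step : ∀ v d → lookup D v ≡ suc d → d ≤ k → lookup D (parent v) ≡ d × CoAdj G v (parent v)
      parent-step v d Dv≡1+d d≤k with reach {v} (s≤s d≤k) (≤-reflexive Dv≡1+d)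
      ... | here = ⊥-elim (1+n≰n (subst (_≤ d) Dv≡1+d (bound (≤-trans d≤k (n≤1+n k)) here)))
      ... | _▹_ {b = b} a⇝b (_ , bv) = D-parent , subst (CoAdj G v) (sym parent≡u) ((λ v≡u → u≢v (sym v≡u)) , vu)
        where
        Db<Dv : lookup D b < lookup D v
        Db<Dv = subst (lookup D b <_) (sym Dv≡1+d) (s≤s (bound (≤-trans d≤k (n≤1+n k)) a⇝b))
        mv<n : lookup m v < n
        mv<n = ≤-<-trans (proj₁ (isMin v) b (nonAdj-sym G bv)) (subst (_< n) (sym (key-closer D Db<Dv)) (toℕ<n b))
        u  = proj₁ (proj₂ (isMin v))
        vu = proj₁ (proj₂ (proj₂ (isMin v)))
        mv≡key = proj₂ (proj₂ (proj₂ (isMin v)))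
        closer = key<n D (subst (_< n) mv≡key mv<n)
        parent≡u : parent v ≡ u
        parent≡u = toℕ-injective (trans (toℕ-mod mv<n) (trans mv≡key (proj₂ closer)))
        Du≤d : lookup D u ≤ d
        Du≤d = ≤-pred (subst (lookup D u <_) Dv≡1+d (proj₁ closer))
        u≢v : u ≢ v
        u≢v u≡v = <-irrefl (cong (lookup D) u≡v) (proj₁ closer)
        d≤Du : d ≤ lookup D u
        d≤Du = ≤-pred (subst (_≤ suc (lookup D u)) Dv≡1+d (bound (s≤s (≤-trans Du≤d d≤k))
          (reach (≤-trans Du≤d (≤-trans d≤k (n≤1+n k))) ≤-refl ▹ (u≢v , nonAdj-sym G vu))))
        D-parent : lookup D (parent v) ≡ d
        D-parent = trans (cong (lookup D) parent≡u) (≤-antisym Du≤d d≤Du)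

      walk : ℕ → Fin n
      walk = fold (vertex y) parent

      walk-step : ∀ t → t ≤ k → lookup D (walk (suc t)) ≡ k ∸ t × CoAdj G (walk t) (walk (suc t))

      walk-dist : ∀ t → t ≤ suc k → lookup D (walk t) ≡ suc k ∸ t
      walk-dist zero    _         = Dy≡1+k
      walk-dist (suc t) (s≤s t≤k) = proj₁ (walk-step t t≤k)

      walk-step t t≤k = parent-step (walk t) (k ∸ t) (trans (walk-dist t (m≤n⇒m≤1+n t≤k)) (+-∸-assoc 1 t≤k)) (m∸n≤m k t)

      φ : Fin (k + 2) → Fin n
      φ = path y m

      index≤1+k : ∀ (j : Fin (k + 2)) → toℕ j ≤ suc k
      index≤1+k j = ≤-pred (subst (toℕ j <_) (+-comm k 2) (toℕ<n j))

      φ-dist : ∀ j → lookup D (φ j) ≡ toℕ j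
      φ-dist j = trans (walk-dist (suc k ∸ toℕ j) (m∸n≤m (suc k) (toℕ j))) (m∸[m∸n]≡n (index≤1+k j))

      φ-injective : ∀ {i j} → φ i ≡ φ j → i ≡ j
      φ-injective {i} {j} φi≡φj = toℕ-injective (trans (sym (φ-dist i)) (trans (cong (lookup D) φi≡φj) (φ-dist j)))

      φ-consecutive : ∀ i j → toℕ j ≡ suc (toℕ i) → CoAdj G (φ j) (φ i)
      φ-consecutive i j j≡1+i =
        subst₂ (λ x z → CoAdj G (walk x) (walk z)) (cong (suc k ∸_) (sym j≡1+i)) (sym (+-∸-assoc 1 i≤k))
        (proj₂ (walk-step (k ∸ toℕ i) (m∸n≤m k (toℕ i))))
        where
        i≤k : toℕ i ≤ k
        i≤k = ≤-pred (subst (_≤ suc k) j≡1+i (index≤1+k j))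

      φ-far : ∀ i j → suc (suc (toℕ i)) ≤ toℕ j → Adj G (φ i) (φ j)
      φ-far i j 2+i≤j with adj G (φ i) (φ j) in φiφj
      ... | true  = refl
      ... | false = ⊥-elim (1+n≰n (≤-trans 2+i≤j
                      (subst (_≤ suc (toℕ i)) (φ-dist j) (bound 1+i≤1+k (φ-reach ▹ (φi≢φj , φiφj))))))
        where
        1+i≤1+k : suc (toℕ i) ≤ suc k
        1+i≤1+k = ≤-trans (n≤1+n _) (≤-trans 2+i≤j (index≤1+k j))
        φ-reach : CoReach G (toℕ i) a (φ i)
        φ-reach = reach (index≤1+k i) (≤-reflexive (φ-dist i))
        φi≢φj : φ i ≢ φ j
        φi≢φj φi≡φj = 1+n≰n (≤-trans (n≤1+n _)
                        (subst (suc (suc (toℕ i)) ≤_) (cong toℕ (sym (φ-injective φi≡φj))) 2+i≤j))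

      φ-induced : InducedCoPath (k + 2) G φ
      φ-induced = φ-injective , adjacency
        where
        co-path-sym : ∀ {i j} → CoPathAdj {k + 2} i j → CoPathAdj j i
        co-path-sym (i≢j , ¬path) = (λ j≡i → i≢j (sym j≡i)) , (λ path → ¬path (swap path))

        ordered : ∀ i j → toℕ i < toℕ j → Adj G (φ i) (φ j) ⇔ CoPathAdj i j
        ordered i j i<j with toℕ j ≟ suc (toℕ i)
        ... | yes j≡1+i = mk⇔ (λ adj → ⊥-elim (true≢false
                                  (trans (sym adj) (nonAdj-sym G (proj₂ (φ-consecutive i j j≡1+i))))))
                              (λ co → ⊥-elim (proj₂ co (inj₂ j≡1+i)))
        ... | no j≢1+i = mk⇔ (λ _ → (λ i≡j → <-irrefl (cong toℕ i≡j) i<j) , ¬path)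
                             (λ _ → φ-far i j (≤∧≢⇒< i<j (λ 1+i≡j → j≢1+i (sym 1+i≡j))))
          where
          ¬path : ¬ PathAdj i j
          ¬path (inj₁ i≡1+j) = <-asym i<j (subst (toℕ j <_) (sym i≡1+j) (n<1+n (toℕ j)))
          ¬path (inj₂ j≡1+i) = j≢1+i j≡1+i

        adjacency : ∀ i j → Adj G (φ i) (φ j) ⇔ CoPathAdj i j
        adjacency i j with <-cmp (toℕ i) (toℕ j)
        ... | tri< i<j _ _ = ordered i j i<j
        ... | tri> _ _ j<i = mk⇔ (λ adj → co-path-sym (Equivalence.to (ordered j i j<i) (trans (Graph.sym G (φ j) (φ i)) adj)))
                                 (λ co → trans (Graph.sym G (φ i) (φ j)) (Equivalence.from (ordered j i j<i) (co-path-sym co)))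
        ... | tri≈ _ i≡j _ with toℕ-injective i≡j
        ...   | refl = mk⇔ (λ adj → ⊥-elim (true≢false (trans (sym adj) (irrefl G (φ i))))) (λ co → ⊥-elim (proj₁ co refl))

  check-run : ∀ {val m} → (∀ v → LeastWithin k v (lookup val v)) → (∀ v → IsLeast labels val v (lookup m v)) →
    ∃ λ o → [ runQ (suc k + W) , just ]′ (checkLabels val m (differs? val m)) ≡ just o × Correct k G o
  check-run {val} {m} least isMin with differs? val m
  ... | no same = inj₁ (λ v → vertex (lookup val v)) , refl ,
    labelling-correct {val} {m} least isMin (λ v → decidable-stable (lookup m v ≟ lookup val v) (λ m≢val → same (v , m≢val)))
  ... | yes (y , my≢valy) with proj₁ (leastWithin-suc {k} {val} least (isMin y))
  ...   | a , a≡my , a⇝y = inj₂ (path (toℕ y) m′) , trans bfs≡ parents≡ , φ-induced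
    where
    open BFS a (toℕ y) (toℕ<n y)
    a↛y : ¬ CoReach G k a y
    a↛y a⇝y = my≢valy (≤-antisym (proj₁ (isMin y) y (nonAdj-refl G y))
                                 (subst (lookup val y ≤_) a≡my (proj₂ (least y) a a⇝y)))
    dists₀ : Dists 0 (source (lookup m y))
    dists₀ v = subst (λ x → Dist 0 v (lookup (source x) v)) a≡my (dist-zero v)
    distances = bfs-run k 0 (source (lookup m y)) (+-identityʳ k) dists₀ W
    D* = proj₁ distances
    dists* = proj₁ (proj₂ distances)
    bfs≡ = proj₂ (proj₂ distances)
    tree = parents-run D* dists*
    m′ = proj₁ tree
    parents≡ = proj₂ (proj₂ tree)
    vertex-y : vertex (toℕ y) ≡ y
    vertex-y = toℕ-injective (toℕ-mod (toℕ<n y))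
    Dy≡1+k : lookup D* (vertex (toℕ y)) ≡ suc k
    Dy≡1+k = subst (λ v → lookup D* v ≡ suc k) (sym vertex-y)
      (≤-antisym (Equivalence.from (proj₁ (dists* y) (suc k) ≤-refl) a⇝y)
                 (≰⇒> λ Dy≤k → a↛y (Equivalence.to (proj₁ (dists* y) k (n≤1+n k)) Dy≤k)))
    open Path D* dists* m′ (proj₁ (proj₂ tree)) Dy≡1+k using (φ-induced)

  correct-run : ∃ λ o → runQ passes (QueryAlg.start algorithm) ≡ just o × Correct k G o
  correct-run with labels-run k 0 (tabulate toℕ) (+-identityʳ k) leastWithin-zero (suc k + W)
  ... | val , m , least , isMin , labels≡ with check-run {val} {m} least isMin
  ...   | o , check≡ , correct = o , trans labels≡ check≡ , correct

n≤2^⌈log2⌉ : ∀ n (rec : Acc _<_ n) → n ≤ 2 ^ ⌈log2⌉ n rec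
n≤2^⌈log2⌉ zero                _        = z≤n
n≤2^⌈log2⌉ (suc zero)          _        = s≤s z≤n
n≤2^⌈log2⌉ (suc (suc m)) (acc rs) = begin
  suc (suc m)                   ≤⟨ s≤s (s≤s m≤2⌈m/2⌉) ⟩
  suc (suc (⌈ m /2⌉ + ⌈ m /2⌉)) ≡⟨ cong suc (+-suc ⌈ m /2⌉ ⌈ m /2⌉) ⟨
  suc ⌈ m /2⌉ + suc ⌈ m /2⌉     ≤⟨ +-mono-≤ half≤ half≤ ⟩
  2 ^ L + 2 ^ L                 ≡⟨ cong (2 ^ L +_) (+-identityʳ (2 ^ L)) ⟨
  2 ^ suc L                     ∎
  where
  open ≤-Reasoning
  L = ⌈log2⌉ (suc ⌈ m /2⌉) (rs (⌈n/2⌉<n m))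
  half≤ : suc ⌈ m /2⌉ ≤ 2 ^ L
  half≤ = n≤2^⌈log2⌉ (suc ⌈ m /2⌉) (rs (⌈n/2⌉<n m))
  m≤2⌈m/2⌉ : m ≤ ⌈ m /2⌉ + ⌈ m /2⌉
  m≤2⌈m/2⌉ = subst (_≤ ⌈ m /2⌉ + ⌈ m /2⌉) (⌊n/2⌋+⌈n/2⌉≡n m) (+-monoˡ-≤ ⌈ m /2⌉ (⌊n/2⌋≤⌈n/2⌉ m))

n≤2^⌈log₂n⌉ : ∀ n → n ≤ 2 ^ ⌈log₂ n ⌉
n≤2^⌈log₂n⌉ n = n≤2^⌈log2⌉ n (<-wellFounded n)

m≤m^[1+n] : ∀ m n → 1 ≤ m → m ≤ m ^ suc n
m≤m^[1+n] (suc m) n _ = subst (_≤ suc m ^ suc n) (*-identityʳ (suc m)) (*-monoʳ-≤ (suc m) (m^n>0 (suc m) n))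

module _ (n₀ k W′ : ℕ) where
  open Algorithm n₀ k W′ using (algorithm; passes)

  registerBits : ℕ
  registerBits = suc W′ + (2 + k)

  coPathFinder : StreamAlg (suc n₀) (memory algorithm registerBits) (Output (suc n₀) k)
  coPathFinder = streamAlg algorithm registerBits

  coPathFinder-solves : suc n₀ < 2 ^ suc W′ → Solves k coPathFinder passes
  coPathFinder-solves n<2^W G L stream with correct-run
    where open Correctness n₀ k W′ registerBits G n<2^W (m≤m+n (suc W′) (2 + k)) (m≤n+m (2 + k) (suc W′))
  ... | o , run≡ , correct =
    o , trans (streamAlg-simulates algorithm registerBits G L stream n<2^Z passes (QueryAlg.start algorithm)) run≡ , correct
    where
    n<2^Z : suc n₀ < 2 ^ registerBits
    n<2^Z = <-≤-trans n<2^W (^-monoʳ-≤ 2 (m≤m+n (suc W′) (2 + k)))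

trivial : ∀ n k → StreamAlg n 0 (Output n k)
trivial n k = record { init = [] ; step = λ m _ → m ; endPass = λ _ → inj₂ (inj₁ λ v → v) }

trivial-solves : ∀ n k → n ≤ 1 → Solves k (trivial n k) 1
trivial-solves n k n≤1 G L _ = inj₁ (λ v → v) , refl , λ u v → mk⇔ (λ { refl → ε }) (λ _ → all-equal n n≤1 u v)
  where
  all-equal : ∀ n → n ≤ 1 → (u v : Fin n) → u ≡ v
  all-equal (suc zero)    _        zero zero = refl
  all-equal (suc (suc _)) (s≤s ()) _    _

-- Both identities put an explicit polynomial with nonnegative coefficients on the left.
passes-slack : ∀ b l → suc (suc b) * suc (suc l) + (suc (suc b) + suc (suc l)) + (19 * b * l + 17 * b + 17 * l + 32)
                     ≡ 20 * suc b * suc l + 20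
passes-slack = solve-∀

memory-slack : ∀ a b l →
  (4 + (suc (suc a) + suc (suc a))) * (suc (suc l) + (2 + suc b)) + suc (suc a) * (suc (suc l) + (2 + suc b))
    + (20 * a * b * l + 17 * a * b + 40 * b * l + 30 * b + 17 * a * l + 5 * a + 30 * l + 10)
  ≡ 20 * suc b * suc (suc a) * suc l + 20
memory-slack = solve-∀

Solvable : (c n k L : ℕ) → Set
Solvable c n k L = Σ ℕ λ p → Σ ℕ λ s → Σ (StreamAlg n s (Output n k)) λ A →
  (p ≤ c * k * L + c) × (s ≤ c * k * n * (L ^ c) + c) × Solves k A p

small-graphs : ∀ n k L → n ≤ 1 → Solvable 20 n k L
small-graphs n k L n≤1 = 1 , 0 , trivial n k , ≤-trans (s≤s z≤n) (m≤n+m 20 (20 * k * L)) , z≤n , trivial-solves n k n≤1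

passes-bound : ∀ n₀ b L → 1 ≤ L → Algorithm.passes n₀ (suc b) L ≤ 20 * suc b * L + 20
passes-bound n₀ b (suc l) _ = ≤-trans (m≤m+n _ _) (≤-reflexive (passes-slack b l))

memory-bound : ∀ a b L → 1 ≤ L →
  memory (Algorithm.algorithm (suc a) (suc b) L) (registerBits (suc a) (suc b) L) ≤ 20 * suc b * suc (suc a) * L + 20
memory-bound a b (suc l) _ = ≤-trans (m≤m+n _ _) (≤-reflexive (memory-slack a b l))

large-graphs : ∀ a b L → 1 ≤ L → suc (suc a) ≤ 2 ^ L → Solvable 20 (suc (suc a)) (suc b) L
large-graphs a b L 1≤L n≤2^L = passes , memory algorithm (registerBits (suc a) (suc b) L) , coPathFinder (suc a) (suc b) L ,
  passes-bound (suc a) b L 1≤L ,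
  ≤-trans (memory-bound a b L 1≤L) (+-monoˡ-≤ 20 (*-monoʳ-≤ (20 * suc b * suc (suc a)) (m≤m^[1+n] L 19 1≤L))) ,
  coPathFinder-solves (suc a) (suc b) L (≤-<-trans n≤2^L (^-monoʳ-< 2 (s≤s (s≤s z≤n)) (n<1+n L)))
  where open Algorithm (suc a) (suc b) L using (algorithm; passes)

lemma25 : Σ ℕ λ c → ∀ (n k : ℕ) → 1 ≤ k →
    Σ ℕ λ p → Σ ℕ λ s → Σ (StreamAlg n s (Output n k)) λ A →
      (p ≤ c * k * ⌈log₂ n ⌉ + c) ×
      (s ≤ c * k * n * (⌈log₂ n ⌉ ^ c) + c) ×
      Solves k A p
lemma25 = 20 , streaming
  where
  streaming : ∀ n k → 1 ≤ k → Solvable 20 n k ⌈log₂ n ⌉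
  streaming zero          k       _ = small-graphs 0 k 0 z≤n
  streaming (suc zero)    k       _ = small-graphs 1 k 0 ≤-refl
  streaming (suc (suc a)) (suc b) _ = large-graphs a b ⌈log₂ suc (suc a) ⌉ (s≤s z≤n) (n≤2^⌈log₂n⌉ (suc (suc a)))
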